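{- There exist a positive integer $k$, a finite multiset of affine functions $\{l_a\}$ on $\mathbb{R}^k$, a finite set $V\subset\mathbb{Z}^k$, and real values $\{c_i\}_{i\in[1,k]}$, $\{c_{ii}\}_{i\in[1,k]}$, $\{c_{ij}\}_{i,j\in[1,k]}$ such that: (1) for every $v\in V$, $\Pr_{l}[l(v)>0]=\frac12$, where $l$ is chosen uniformly from the multiset $\{l_a\}$; (2) for every $a$ there is a probability distribution $D_a$ supported on $\{v\in V: l_a(v)>0\}$ with $\mathbb{E}_{v\sim D_a}[v_i]=c_i$ and $\mathbb{E}_{v\sim D_a}[v_i^2]=c_{ii}$ for all $i$, and $\mathbb{E}_{v\sim D_a}[v_iv_j]=c_{ij}$ for all $i,j$. Moreover, $V$ and the values $\{c_i\},\{c_{ii}\},\{c_{ij}\}$ may be taken to be symmetric under permutations of the $k$ coordinates, and all the $l_a$ may be taken to coincide with a single affine function $l$ up to permuting its input variables.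
   Context: An affine function on $\mathbb{R}^k$ is a map $x\mapsto \sum_{i=1}^k w_ix_i + w_0$ with real coefficients (a constant term is allowed). -}

module Defs where

open import Data.Nat using (ℕ; zero; suc)
open import Data.Integer using (ℤ)
open import Data.Rational using (ℚ; 0ℚ; _+_; _*_; _/_; _<_; _≤_)
open import Data.Fin using (Fin; zero; suc)
open import Data.Fin.Permutation using (Permutation′; _⟨$⟩ʳ_)
open import Data.Vec using (Vec; lookup; tabulate)
open import Data.List using (length; filter; allFin)
open import Data.Rational.Properties using (_<?_)

Σ : ∀ {n} → (Fin n → ℚ) → ℚ
Σ {zero}  f = 0ℚ
Σ {suc n} f = f zero + Σ (λ i → f (suc i))

record Affine (k : ℕ) : Set where
  constructor affine
  field
    w  : Fin k → ℚ
    w₀ : ℚ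

eval : ∀ {k} → Affine k → (Fin k → ℚ) → ℚ
eval (affine w w₀) x = Σ (λ i → w i * x i) + w₀

toℚ : ∀ {k} → Vec ℤ k → Fin k → ℚ
toℚ v i = lookup v i / 1

permVec : ∀ {k} → Permutation′ k → Vec ℤ k → Vec ℤ k
permVec σ v = tabulate (λ i → lookup v (σ ⟨$⟩ʳ i))

permPt : ∀ {k} → Permutation′ k → (Fin k → ℚ) → Fin k → ℚ
permPt σ x i = x (σ ⟨$⟩ʳ i)

countPos : ∀ {k m} → (Fin m → Affine k) → Vec ℤ k → ℕ
countPos {m = m} ls v = length (filter (λ a → 0ℚ <? eval (ls a) (toℚ v)) (allFin m))

coord : ∀ {k} → Vec ℤ k → Fin k → ℚ
coord v i = toℚ v i

{-# OPTIONS --safe #-}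
-- Take k = 4 and l_a(x) = x_a − ½, so that Pr_l[l(v) > 0] is a quarter of the number of
-- coordinates of v that are at least 1.  Let V consist of all coordinate permutations of
-- (1, 7, 0, 0) and (14, 2, −4, −4): each has exactly two coordinates ≥ 1.  D_a puts mass
-- 4/13 on each of the three points with v_a = 1 and mass 1/39 on each of the three points
-- with v_a = 14; every D_a then has the moments c_i = 2, c_ii = 16 and c_ij = 0 (i ≠ j).
module Submission where

open import Defs
open import Data.Nat using (ℕ; _≥_; s≤s; z≤n)
open import Data.Integer using (ℤ)
open import Data.Rational using (ℚ; 0ℚ; 1ℚ; _*_; _+_; _<_; _≤_; _/_; -½)
open import Data.Rational.Properties
  using (_≟_; _≤?_; _<?_; *-identityˡ; *-zeroˡ; +-identityˡ; +-identityʳ)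
open import Data.Fin using (Fin; zero; suc)
open import Data.Fin.Properties using (all?; any?) renaming (_≟_ to _≟ᶠ_)
open import Data.Fin.Permutation using (Permutation′; _⟨$⟩ʳ_; transpose)
open import Data.Vec using (Vec; []; _∷_; lookup; tabulate; map)
open import Data.Vec.Properties using (≡-dec; lookup∘tabulate)
open import Data.Bool using (if_then_else_)
open import Data.Product using (Σ-syntax; ∃-syntax; _×_; _,_)
open import Function.Bundles using (Injection)
open import Function.Definitions using (Injective)
open import Function.Properties.Inverse using (↔⇒↣)
open import Relation.Nullary using (does; yes; no; contradiction)
open import Relation.Nullary.Decidable using (from-yes; _→-dec_)
open import Relation.Binary.PropositionalEquality using (_≡_; refl; sym; trans; cong; cong₂; module ≡-Reasoning)
import Data.Integer as ℤ
open import Agda.Builtin.FromNat using (Number; fromNat)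
open import Agda.Builtin.FromNeg using (Negative; fromNeg)
open import Data.Unit using (tt)
import Data.Nat.Literals as ℕ-Literals
import Data.Integer.Literals as ℤ-Literals
import Data.Rational.Literals as ℚ-Literals

instance
  ℕ-number : Number ℕ
  ℕ-number = ℕ-Literals.number

  ℤ-number : Number ℤ
  ℤ-number = ℤ-Literals.number

  ℤ-negative : Negative ℤ
  ℤ-negative = ℤ-Literals.negative

  ℚ-number : Number ℚ
  ℚ-number = ℚ-Literals.number

δ : ∀ {n} → Fin n → Fin n → ℚ
δ i j = if does (i ≟ᶠ j) then 1ℚ else 0ℚ

Σ-cong : ∀ {n} {f g : Fin n → ℚ} → (∀ i → f i ≡ g i) → Σ f ≡ Σ g
Σ-cong {ℕ.zero}  f≡g = refl
Σ-cong {ℕ.suc n} f≡g = cong₂ _+_ (f≡g zero) (Σ-cong (λ i → f≡g (suc i)))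

Σ-zero : ∀ n → Σ {n} (λ _ → 0ℚ) ≡ 0ℚ
Σ-zero ℕ.zero    = refl
Σ-zero (ℕ.suc n) = cong (0ℚ +_) (Σ-zero n)

Σ-δ : ∀ {n} (a : Fin n) (x : Fin n → ℚ) → Σ (λ i → δ a i * x i) ≡ x a
Σ-δ {ℕ.suc n} zero x = begin
  1ℚ * x zero + Σ (λ i → 0ℚ * x (suc i))  ≡⟨ cong₂ _+_ (*-identityˡ (x zero))
                                                        (Σ-cong (λ i → *-zeroˡ (x (suc i)))) ⟩
  x zero + Σ {n} (λ _ → 0ℚ)               ≡⟨ cong (x zero +_) (Σ-zero n) ⟩
  x zero + 0ℚ                             ≡⟨ +-identityʳ (x zero) ⟩
  x zero                                  ∎
  where open ≡-Reasoning
Σ-δ (suc a) x = begin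
  0ℚ * x zero + Σ (λ i → δ a i * x (suc i))  ≡⟨ cong₂ _+_ (*-zeroˡ (x zero)) (Σ-δ a (λ i → x (suc i))) ⟩
  0ℚ + x (suc a)                             ≡⟨ +-identityˡ (x (suc a)) ⟩
  x (suc a)                                  ∎
  where open ≡-Reasoning

δ-reindex : ∀ {m n} {f : Fin m → Fin n} → Injective _≡_ _≡_ f → ∀ i j → δ (f i) (f j) ≡ δ i j
δ-reindex {f = f} f-inj i j with f i ≟ᶠ f j | i ≟ᶠ j
... | yes _    | yes _   = refl
... | no _     | no _    = refl
... | yes fi≡fj | no i≢j = contradiction (f-inj fi≡fj) i≢j
... | no fi≢fj | yes refl = contradiction refl fi≢fj

permutation-injective : ∀ {n} (σ : Permutation′ n) → Injective _≡_ _≡_ (σ ⟨$⟩ʳ_)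
permutation-injective σ = Injection.injective (↔⇒↣ σ)

coordinateAffine : ∀ {k} → Fin k → ℚ → Affine k
coordinateAffine a w₀ = affine (δ a) w₀

eval-coordinateAffine : ∀ {k} (a : Fin k) w₀ x → eval (coordinateAffine a w₀) x ≡ x a + w₀
eval-coordinateAffine a w₀ x = cong (_+ w₀) (Σ-δ a x)

coordinateAffine-transpose : ∀ {k} (a : Fin (ℕ.suc k)) w₀ x →
  eval (coordinateAffine a w₀) x ≡ eval (coordinateAffine zero w₀) (permPt (transpose zero a) x)
coordinateAffine-transpose a w₀ x = begin
  eval (coordinateAffine a w₀) x                                 ≡⟨ eval-coordinateAffine a w₀ x ⟩
  x a + w₀                                                       ≡⟨⟩
  permPt (transpose zero a) x zero + w₀                          ≡⟨ eval-coordinateAffine zero w₀ (permPt (transpose zero a) x) ⟨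
  eval (coordinateAffine zero w₀) (permPt (transpose zero a) x)  ∎
  where open ≡-Reasoning

tabulate-injective : ∀ {a} {A : Set a} {n} {f : Fin n → A} →
  Injective _≡_ _≡_ f → Injective _≡_ _≡_ (lookup (tabulate f))
tabulate-injective {f = f} f-inj {i} {i′} eq =
  f-inj (trans (sym (lookup∘tabulate f i)) (trans eq (lookup∘tabulate f i′)))

points : Vec (Vec ℤ 4) 24
points =
  (1 ∷ 7 ∷ 0 ∷ 0 ∷ []) ∷ (1 ∷ 0 ∷ 7 ∷ 0 ∷ []) ∷ (1 ∷ 0 ∷ 0 ∷ 7 ∷ []) ∷
  (7 ∷ 1 ∷ 0 ∷ 0 ∷ []) ∷ (7 ∷ 0 ∷ 1 ∷ 0 ∷ []) ∷ (7 ∷ 0 ∷ 0 ∷ 1 ∷ []) ∷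
  (0 ∷ 1 ∷ 7 ∷ 0 ∷ []) ∷ (0 ∷ 1 ∷ 0 ∷ 7 ∷ []) ∷ (0 ∷ 7 ∷ 1 ∷ 0 ∷ []) ∷
  (0 ∷ 7 ∷ 0 ∷ 1 ∷ []) ∷ (0 ∷ 0 ∷ 1 ∷ 7 ∷ []) ∷ (0 ∷ 0 ∷ 7 ∷ 1 ∷ []) ∷
  (14 ∷ 2 ∷ -4 ∷ -4 ∷ []) ∷ (14 ∷ -4 ∷ 2 ∷ -4 ∷ []) ∷ (14 ∷ -4 ∷ -4 ∷ 2 ∷ []) ∷
  (2 ∷ 14 ∷ -4 ∷ -4 ∷ []) ∷ (2 ∷ -4 ∷ 14 ∷ -4 ∷ []) ∷ (2 ∷ -4 ∷ -4 ∷ 14 ∷ []) ∷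
  (-4 ∷ 14 ∷ 2 ∷ -4 ∷ []) ∷ (-4 ∷ 14 ∷ -4 ∷ 2 ∷ []) ∷ (-4 ∷ 2 ∷ 14 ∷ -4 ∷ []) ∷
  (-4 ∷ 2 ∷ -4 ∷ 14 ∷ []) ∷ (-4 ∷ -4 ∷ 14 ∷ 2 ∷ []) ∷ (-4 ∷ -4 ∷ 2 ∷ 14 ∷ []) ∷ []

V : Fin 24 → Vec ℤ 4
V = lookup points

l : Fin 4 → Affine 4
l a = coordinateAffine a -½

weight : ℤ → ℚ
weight (ℤ.+ 1)  = 4 / 13
weight (ℤ.+ 14) = 1 / 39
weight _        = 0ℚ

D : Fin 4 → Fin 24 → ℚ
D a j = weight (lookup (V j) a)

c : Fin 4 → ℚ
c _ = 2

cij : Fin 4 → Fin 4 → ℚ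
cij i i′ = 16 * δ i i′

cii : Fin 4 → ℚ
cii i = cij i i

cij-permutation : ∀ (σ : Permutation′ 4) i i′ → cij (σ ⟨$⟩ʳ i) (σ ⟨$⟩ʳ i′) ≡ cij i i′
cij-permutation σ i i′ = cong (16 *_) (δ-reindex (permutation-injective σ) i i′)

V-injective : Injective _≡_ _≡_ V
V-injective {j} {j′} = from-yes (all? λ j → all? λ j′ → ≡-dec ℤ._≟_ (V j) (V j′) →-dec (j ≟ᶠ j′)) j j′

2*countPos-l-V≡4 : ∀ j → 2 Data.Nat.* countPos l (V j) ≡ 4
2*countPos-l-V≡4 = from-yes (all? λ j → 2 Data.Nat.* countPos l (V j) Data.Nat.≟ 4)

D-nonneg : ∀ a j → 0ℚ ≤ D a j
D-nonneg = from-yes (all? λ a → all? λ j → 0ℚ ≤? D a j)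

Σ-D≡1 : ∀ a → Σ (D a) ≡ 1ℚ
Σ-D≡1 = from-yes (all? λ a → Σ (D a) ≟ 1ℚ)

D-support : ∀ a j → 0ℚ < D a j → 0ℚ < eval (l a) (toℚ (V j))
D-support = from-yes (all? λ a → all? λ j → (0ℚ <? D a j) →-dec (0ℚ <? eval (l a) (toℚ (V j))))

D-mean : ∀ a i → Σ (λ j → D a j * coord (V j) i) ≡ c i
D-mean = from-yes (all? λ a → all? λ i → Σ (λ j → D a j * coord (V j) i) ≟ c i)

D-second-moment : ∀ a i i′ → Σ (λ j → D a j * (coord (V j) i * coord (V j) i′)) ≡ cij i i′
D-second-moment = from-yes (all? λ a → all? λ i → all? λ i′ →
  Σ (λ j → D a j * (coord (V j) i * coord (V j) i′)) ≟ cij i i′)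

-- σ acts on a point only through the injective tuple (σ 0, …, σ 3), and such tuples can be
-- enumerated although permutations cannot.
V-closed-under-injections : ∀ j a₀ a₁ a₂ a₃ → let τ = a₀ ∷ a₁ ∷ a₂ ∷ a₃ ∷ [] in
  (∀ i i′ → lookup τ i ≡ lookup τ i′ → i ≡ i′) → ∃[ j′ ] V j′ ≡ map (lookup (V j)) τ
V-closed-under-injections = from-yes (all? λ j → all? λ a₀ → all? λ a₁ → all? λ a₂ → all? λ a₃ →
  let τ = a₀ ∷ a₁ ∷ a₂ ∷ a₃ ∷ [] in
  (all? λ i → all? λ i′ → (lookup τ i ≟ᶠ lookup τ i′) →-dec (i ≟ᶠ i′)) →-dec
  any? λ j′ → ≡-dec ℤ._≟_ (V j′) (map (lookup (V j)) τ))

V-closed-under-permutations : ∀ (σ : Permutation′ 4) j → ∃[ j′ ] V j′ ≡ permVec σ (V j)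
V-closed-under-permutations σ j =
  V-closed-under-injections j _ _ _ _ (λ _ _ → tabulate-injective (permutation-injective σ))

mainTheorem4 :
  Σ[ k ∈ ℕ ] Σ[ m ∈ ℕ ] Σ[ ls ∈ (Fin m → Affine k) ]
  Σ[ n ∈ ℕ ] Σ[ V ∈ (Fin n → Vec ℤ k) ]
  Σ[ c ∈ (Fin k → ℚ) ] Σ[ cii ∈ (Fin k → ℚ) ] Σ[ cij ∈ (Fin k → Fin k → ℚ) ]
    ( k ≥ 1
    × m ≥ 1
    × Injective _≡_ _≡_ V
    -- (1) Pr_l[l(v) > 0] = 1/2 for every v ∈ V
    × (∀ j → 2 Data.Nat.* countPos ls (V j) ≡ m)
    -- (2) a distribution D_a on V supported on {v ∈ V : l_a(v) > 0} with the given moments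
    × (∀ a → Σ[ p ∈ (Fin n → ℚ) ]
          ( (∀ j → 0ℚ ≤ p j)
          × Defs.Σ p ≡ 1ℚ
          × (∀ j → 0ℚ < p j → 0ℚ < eval (ls a) (toℚ (V j)))
          × (∀ i → Defs.Σ (λ j → p j * coord (V j) i) ≡ c i)
          × (∀ i → Defs.Σ (λ j → p j * (coord (V j) i * coord (V j) i)) ≡ cii i)
          × (∀ i i′ → Defs.Σ (λ j → p j * (coord (V j) i * coord (V j) i′)) ≡ cij i i′)))
    -- Moreover: symmetry under coordinate permutations
    × (∀ (σ : Permutation′ k) j → ∃[ j′ ] V j′ ≡ permVec σ (V j))
    × (∀ (σ : Permutation′ k) i → c (σ Data.Fin.Permutation.⟨$⟩ʳ i) ≡ c i)
    × (∀ (σ : Permutation′ k) i → cii (σ Data.Fin.Permutation.⟨$⟩ʳ i) ≡ cii i)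
    × (∀ (σ : Permutation′ k) i i′ →
         cij (σ Data.Fin.Permutation.⟨$⟩ʳ i) (σ Data.Fin.Permutation.⟨$⟩ʳ i′) ≡ cij i i′)
    -- all l_a coincide with one affine l up to permuting its input variables
    × (Σ[ l ∈ Affine k ] ∀ a → ∃[ σ ] ∀ (x : Fin k → ℚ) → eval (ls a) x ≡ eval l (permPt σ x)))
mainTheorem4 =
  4 , 4 , l , 24 , V , c , cii , cij ,
  ( s≤s z≤n
  , s≤s z≤n
  , V-injective
  , 2*countPos-l-V≡4
  , (λ a → D a , D-nonneg a , Σ-D≡1 a , D-support a
           , D-mean a , (λ i → D-second-moment a i i) , D-second-moment a)
  , V-closed-under-permutations
  , (λ σ i → refl)
  , (λ σ i → cij-permutation σ i i)
  , cij-permutation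
  , (l zero , λ a → transpose zero a , coordinateAffine-transpose a -½))
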